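{- Assume countable choice and Church's thesis. Then every partial function $f:\mathbb N\to\mathcal L(\mathbb N)$ such that $\operatorname{defined}(f(n))$ is a Rosolini proposition for every $n:\mathbb N$ is computable.
   Context: Type theory: Martin-Löf type theory with universe $\mathcal U$, function extensionality, proposition extensionality and propositional truncations. $\mathcal L(Y):=\sum_{P:\mathcal U}\operatorname{isProp}(P)\times(P\to Y)$, with $\eta(y)=(1,-,\lambda u.y)$. A proposition $P$ is Rosolini if there merely exists $\alpha:\mathbb N\to 2$ with at most one $1$ such that $P=\sum_n(\alpha_n=1)$. Fix the primitive recursive encoding $\mathrm{inl}(n)=2n$, $\mathrm{inr}(n)=2n+1$ of $\mathbb N+\mathbb N$ in $\mathbb N$. A recursive machine is a pair $m=(i,s)$ of unary primitive recursive functions (given as primitive recursive combinators), $s$ read as $\mathbb N\to\mathbb N+\mathbb N$. Let $s'(\mathrm{inl}\,x)=s(x)$, $s'(\mathrm{inr}\,y)=\mathrm{inr}\,y$, and $\operatorname{run}_k(m,x):=s'^k(\mathrm{inl}(i(x)))$. The partial function computed by $m$ is $\operatorname{eval}(m)(x)$ with extent $\sum_{y:\mathbb N}\lVert\sum_k\operatorname{run}_k(m,x)=\mathrm{inr}\,y\rVert$ and value the first projection. $f$ is computable if $\lVert\sum_{m}f=\operatorname{eval}(m)\rVert$. Church's thesis: every $g:\mathbb N\to\mathbb N$ has $\eta\circ g$ computable. Countable choice: for every $Y:\mathbb N\to\mathcal U$, $(\prod_n\lVert Y(n)\rVert)\to\lVert\prod_nY(n)\rVert$. -}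

module Defs where

open import Level using (Level; _⊔_; Setω) renaming (zero to lzero; suc to lsuc)
open import Data.Nat using (ℕ; zero; suc; _+_)
open import Data.Nat.Properties using (+-comm; ≡-irrelevant; suc-injective)
open import Data.Bool using (Bool; true; false)
open import Data.Fin using (Fin)
open import Data.Vec using (Vec; []; _∷_; lookup)
open import Data.Sum using (_⊎_; inj₁; inj₂)
open import Data.Product using (Σ; _×_; _,_; proj₁; proj₂)
open import Data.Unit using (⊤; tt)
open import Function using (_∘_)
open import Relation.Binary.PropositionalEquality
  using (_≡_; refl; sym; trans; cong; subst)

isProp : ∀ {a} → Set a → Set a
isProp P = (x y : P) → x ≡ y

FunExt : Setω
FunExt = ∀ {a b} {A : Set a} {B : A → Set b} {f g : (x : A) → B x}
         → ((x : A) → f x ≡ g x) → f ≡ g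

PropExt : Set₁
PropExt = ∀ {P Q : Set} → isProp P → isProp Q → (P → Q) → (Q → P) → P ≡ Q

record PropTrunc : Setω where
  field
    ∥_∥      : ∀ {a} → Set a → Set a
    ∥∥-isProp : ∀ {a} {A : Set a} → isProp ∥ A ∥
    ∣_∣      : ∀ {a} {A : Set a} → A → ∥ A ∥
    ∥∥-rec   : ∀ {a b} {A : Set a} {B : Set b} → isProp B → (A → B) → ∥ A ∥ → B

𝓛 : Set → Set₁
𝓛 Y = Σ Set (λ P → isProp P × (P → Y))

defined : ∀ {Y} → 𝓛 Y → Set
defined = proj₁

η : ∀ {Y} → Y → 𝓛 Y
η y = ⊤ , (λ _ _ → refl) , (λ _ → y)

data PR : ℕ → Set where
  pzero : ∀ {n} → PR n
  psucc : PR 1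
  pproj : ∀ {n} → Fin n → PR n
  pcomp : ∀ {m n} → PR m → Vec (PR n) m → PR n
  prec  : ∀ {n} → PR n → PR (suc (suc n)) → PR (suc n)

recN : ∀ {n} → (Vec ℕ n → ℕ) → (Vec ℕ (suc (suc n)) → ℕ) → ℕ → Vec ℕ n → ℕ
recN g h zero    xs = g xs
recN g h (suc k) xs = h (k ∷ recN g h k xs ∷ xs)

mutual
  ⟦_⟧ : ∀ {n} → PR n → Vec ℕ n → ℕ
  ⟦ pzero ⟧      xs       = 0
  ⟦ psucc ⟧      (x ∷ []) = suc x
  ⟦ pproj i ⟧    xs       = lookup xs i
  ⟦ pcomp f gs ⟧ xs       = ⟦ f ⟧ (⟦ gs ⟧* xs)
  ⟦ prec g h ⟧   (k ∷ xs) = recN ⟦ g ⟧ ⟦ h ⟧ k xs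

  ⟦_⟧* : ∀ {m n} → Vec (PR n) m → Vec ℕ n → Vec ℕ m
  ⟦ [] ⟧*     xs = []
  ⟦ g ∷ gs ⟧* xs = ⟦ g ⟧ xs ∷ ⟦ gs ⟧* xs

⟦_⟧₁ : PR 1 → ℕ → ℕ
⟦ p ⟧₁ x = ⟦ p ⟧ (x ∷ [])

encode : ℕ ⊎ ℕ → ℕ
encode (inj₁ n) = n + n
encode (inj₂ n) = suc (n + n)

decode : ℕ → ℕ ⊎ ℕ
decode zero          = inj₁ zero
decode (suc zero)    = inj₂ zero
decode (suc (suc n)) with decode n
... | inj₁ m = inj₁ (suc m)
... | inj₂ m = inj₂ (suc m)

Machine : Set
Machine = PR 1 × PR 1

-- s' on ℕ + ℕ (s is read as ℕ → ℕ + ℕ through the encoding)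
step : Machine → ℕ ⊎ ℕ → ℕ ⊎ ℕ
step (i , s) (inj₁ x) = decode (⟦ s ⟧₁ x)
step (i , s) (inj₂ y) = inj₂ y

iter : ∀ {A : Set} → ℕ → (A → A) → A → A
iter zero    f a = a
iter (suc k) f a = f (iter k f a)

run : ℕ → Machine → ℕ → ℕ ⊎ ℕ
run k m x = iter k (step m) (inj₁ (⟦ proj₁ m ⟧₁ x))

private
  run-stable : ∀ m x k y j → run k m x ≡ inj₂ y → run (j + k) m x ≡ inj₂ y
  run-stable m x k y zero    e = e
  run-stable m x k y (suc j) e rewrite run-stable m x k y j e = refl

  inj₂-inj : ∀ {a b : ℕ} → _≡_ {A = ℕ ⊎ ℕ} (inj₂ a) (inj₂ b) → a ≡ b
  inj₂-inj refl = refl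

  run-unique : ∀ m x k k' y y' → run k m x ≡ inj₂ y → run k' m x ≡ inj₂ y' → y ≡ y'
  run-unique m x k k' y y' e e' =
    inj₂-inj (trans (sym (run-stable m x k y k' e))
               (subst (λ t → run t m x ≡ inj₂ y') (+-comm k k') (run-stable m x k' y' k e')))

module WithTrunc (pt : PropTrunc) where
  open PropTrunc pt

  Extent : Machine → ℕ → Set
  Extent m x = Σ ℕ (λ y → ∥ Σ ℕ (λ k → run k m x ≡ inj₂ y) ∥)

  Extent-isProp : ∀ m x → isProp (Extent m x)
  Extent-isProp m x (y , t) (y' , t') with
    ∥∥-rec (≡-irrelevant {y} {y'})
      (λ { (k , e) → ∥∥-rec (≡-irrelevant {y} {y'})
                       (λ { (k' , e') → run-unique m x k k' y y' e e' }) t' }) t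
  ... | refl = cong (y ,_) (∥∥-isProp t t')

  eval : Machine → ℕ → 𝓛 ℕ
  eval m x = Extent m x , Extent-isProp m x , proj₁

  isComputable : (ℕ → 𝓛 ℕ) → Set₁
  isComputable f = ∥ Σ Machine (λ m → f ≡ eval m) ∥

  AtMostOne : (ℕ → Bool) → Set
  AtMostOne α = ∀ n n' → α n ≡ true → α n' ≡ true → n ≡ n'

  isRosolini : Set → Set₁
  isRosolini P = ∥ Σ (ℕ → Bool) (λ α → AtMostOne α × (P ≡ Σ ℕ (λ n → α n ≡ true))) ∥

  ChurchThesis : Set₁
  ChurchThesis = (g : ℕ → ℕ) → isComputable (η ∘ g)

  CountableChoice : Set₁
  CountableChoice = (Y : ℕ → Set) → ((n : ℕ) → ∥ Y n ∥) → ∥ ((n : ℕ) → Y n) ∥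

-- By countable choice pick, for every n, a sequence α n with  defined (f n) ⇔ ∃ k. α n k ≡ true.
-- The total function sending the code of (n , k) to "halt with the value of f n" when α n k is
-- true and to "continue with the code of (n , k + 1)" otherwise is computed, by Church's thesis,
-- by some machine m.  A machine that runs m, feeds every "continue" output back to m and halts on
-- "halt" carries out the search for the first k with α n k ≡ true, so it halts on n exactly when
-- f n is defined, and then outputs its value.
module Submission where

open import Axiom.UniquenessOfIdentityProofs.WithK using (uip)
open import Data.Bool using (Bool; true; false)
open import Data.Fin using () renaming (zero to #0; suc to 1+)
open import Data.Nat using (ℕ; zero; suc; _+_; _<_; z≤n; s≤s)
open import Data.Nat.Properties using (+-suc; +-comm; +-mono-≤; ≤-trans)
open import Data.Product using (Σ; _×_; _,_; proj₁; proj₂; map₂; uncurry)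
open import Data.Sum using (_⊎_; inj₁; inj₂; [_,_]′; map₁)
open import Data.Sum.Properties using (inj₂-injective)
open import Data.Unit using (tt)
open import Data.Vec using ([]; _∷_)
open import Function using (_∘_)
open import Function.Bundles using (_⇔_; mk⇔; module Equivalence)
open import Relation.Binary.PropositionalEquality
  using (_≡_; refl; sym; trans; cong; cong-app; subst; module ≡-Reasoning)

open import Defs

value : ∀ {Y} (l : 𝓛 Y) → defined l → Y
value l = proj₂ (proj₂ l)

value-irrelevant : ∀ {Y} (l : 𝓛 Y) d d′ → value l d ≡ value l d′
value-irrelevant l d d′ = cong (value l) (proj₁ (proj₂ l) d d′)

η-≡ : ∀ {Y} {y : Y} {l : 𝓛 Y} → η y ≡ l → Σ (defined l) (λ d → value l d ≡ y)
η-≡ refl = tt , refl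

𝓛-ext : FunExt → PropExt → ∀ {Y} (l l′ : 𝓛 Y) (to : defined l → defined l′) →
        (defined l′ → defined l) → (∀ d → value l d ≡ value l′ (to d)) → l ≡ l′
𝓛-ext funext propext (P , P-prop , v) (Q , Q-prop , w) to from v≡w
  with propext P-prop Q-prop to from
... | refl with funext (λ p → funext (λ q → uip (P-prop p q) (Q-prop p q)))
              | funext (λ p → trans (v≡w p) (cong w (Q-prop (to p) p)))
...   | refl | refl = refl

decode-encode : ∀ x → decode (encode x) ≡ x
decode-encode (inj₁ a) = decode-double a
  where
  decode-double : ∀ a → decode (a + a) ≡ inj₁ a
  decode-double zero = refl
  decode-double (suc a) rewrite +-suc a a | decode-double a = refl
decode-encode (inj₂ a) = decode-double+1 a
  where
  decode-double+1 : ∀ a → decode (suc (a + a)) ≡ inj₂ a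
  decode-double+1 zero = refl
  decode-double+1 (suc a) rewrite +-suc a a | decode-double+1 a = refl

encode-decode : ∀ w → encode (decode w) ≡ w
encode-decode zero = refl
encode-decode (suc zero) = refl
encode-decode (suc (suc w)) with decode w | encode-decode w
... | inj₁ a | refl = cong suc (+-suc a a)
... | inj₂ a | refl = cong (suc ∘ suc) (+-suc a a)

infixr 9 _∘₁_
_∘₁_ : PR 1 → PR 1 → PR 1
p ∘₁ q = pcomp p (q ∷ [])

pr-add : PR 2
pr-add = prec (pproj #0) (pcomp psucc (pproj (1+ #0) ∷ []))

⟦pr-add⟧ : ∀ a b → ⟦ pr-add ⟧ (a ∷ b ∷ []) ≡ a + b
⟦pr-add⟧ zero    b = refl
⟦pr-add⟧ (suc a) b = cong suc (⟦pr-add⟧ a b)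

-- ⟦ pr-if0 ⟧ (c ∷ x ∷ y ∷ []) is x if c ≡ 0 and y otherwise.
pr-if0 : PR 3
pr-if0 = prec (pproj #0) (pproj (1+ (1+ (1+ #0))))

pr-parity : PR 1
pr-parity = prec pzero (pcomp pr-if0 (pproj (1+ #0) ∷ pcomp psucc (pzero ∷ []) ∷ pzero ∷ []))

parity-double : ∀ a → ⟦ pr-parity ⟧₁ (a + a) ≡ 0
parity-double+1 : ∀ a → ⟦ pr-parity ⟧₁ (suc (a + a)) ≡ 1
parity-double zero = refl
parity-double (suc a) rewrite +-suc a a | parity-double+1 a = refl
parity-double+1 a rewrite parity-double a = refl

pr-half : PR 1
pr-half = prec pzero (pcomp pr-add (pcomp pr-parity (pproj #0 ∷ []) ∷ pproj (1+ #0) ∷ []))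

half-double : ∀ a → ⟦ pr-half ⟧₁ (a + a) ≡ a
half-double+1 : ∀ a → ⟦ pr-half ⟧₁ (suc (a + a)) ≡ a
half-double zero = refl
half-double (suc a)
  rewrite +-suc a a
        | ⟦pr-add⟧ (⟦ pr-parity ⟧₁ (suc (a + a))) (⟦ pr-half ⟧₁ (suc (a + a)))
        | parity-double+1 a | half-double+1 a = refl
half-double+1 a
  rewrite ⟦pr-add⟧ (⟦ pr-parity ⟧₁ (a + a)) (⟦ pr-half ⟧₁ (a + a))
        | parity-double a | half-double a = refl

pr-inl : PR 1
pr-inl = pcomp pr-add (pproj #0 ∷ pproj #0 ∷ [])

⟦pr-inl⟧ : ∀ a → ⟦ pr-inl ⟧₁ a ≡ encode (inj₁ a)
⟦pr-inl⟧ a = ⟦pr-add⟧ a a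

pr-inr : PR 1
pr-inr = psucc ∘₁ pr-inl

⟦pr-inr⟧ : ∀ a → ⟦ pr-inr ⟧₁ a ≡ encode (inj₂ a)
⟦pr-inr⟧ a = cong suc (⟦pr-inl⟧ a)

pr-case : PR 1 → PR 1 → PR 1
pr-case l r = pcomp pr-if0 (pr-parity ∷ l ∘₁ pr-half ∷ r ∘₁ pr-half ∷ [])

⟦pr-case⟧ : ∀ l r x → ⟦ pr-case l r ⟧₁ (encode x) ≡ [ ⟦ l ⟧₁ , ⟦ r ⟧₁ ]′ x
⟦pr-case⟧ l r (inj₁ a) rewrite parity-double a   | half-double a   = refl
⟦pr-case⟧ l r (inj₂ a) rewrite parity-double+1 a | half-double+1 a = refl

pr-map₁ : PR 1 → PR 1
pr-map₁ i = pr-case (pr-inl ∘₁ i) pr-inr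

⟦pr-map₁⟧ : ∀ i x → ⟦ pr-map₁ i ⟧₁ (encode x) ≡ encode (map₁ ⟦ i ⟧₁ x)
⟦pr-map₁⟧ i (inj₁ a) = trans (⟦pr-case⟧ (pr-inl ∘₁ i) pr-inr (inj₁ a)) (⟦pr-inl⟧ (⟦ i ⟧₁ a))
⟦pr-map₁⟧ i (inj₂ a) = trans (⟦pr-case⟧ (pr-inl ∘₁ i) pr-inr (inj₂ a)) (⟦pr-inr⟧ a)

resume : PR 1 → ℕ ⊎ ℕ → ℕ ⊎ ℕ
resume i = [ inj₁ , map₁ ⟦ i ⟧₁ ∘ decode ]′

pr-resume : PR 1 → PR 1
pr-resume i = pr-case pr-inl (pr-map₁ i)

⟦pr-resume⟧ : ∀ i x → ⟦ pr-resume i ⟧₁ (encode x) ≡ encode (resume i x)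
⟦pr-resume⟧ i (inj₁ z) = trans (⟦pr-case⟧ pr-inl (pr-map₁ i) (inj₁ z)) (⟦pr-inl⟧ z)
⟦pr-resume⟧ i (inj₂ b) = begin
  ⟦ pr-resume i ⟧₁ (encode (inj₂ b))   ≡⟨ ⟦pr-case⟧ pr-inl (pr-map₁ i) (inj₂ b) ⟩
  ⟦ pr-map₁ i ⟧₁ b                     ≡⟨ cong ⟦ pr-map₁ i ⟧₁ (sym (encode-decode b)) ⟩
  ⟦ pr-map₁ i ⟧₁ (encode (decode b))   ≡⟨ ⟦pr-map₁⟧ i (decode b) ⟩
  encode (map₁ ⟦ i ⟧₁ (decode b))      ∎
  where open ≡-Reasoning

decode-pr-resume : ∀ i w → decode (⟦ pr-resume i ⟧₁ w) ≡ resume i (decode w)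
decode-pr-resume i w = begin
  decode (⟦ pr-resume i ⟧₁ w)                  ≡⟨ cong (decode ∘ ⟦ pr-resume i ⟧₁) (sym (encode-decode w)) ⟩
  decode (⟦ pr-resume i ⟧₁ (encode (decode w))) ≡⟨ cong decode (⟦pr-resume⟧ i (decode w)) ⟩
  decode (encode (resume i (decode w)))        ≡⟨ decode-encode _ ⟩
  resume i (decode w)                          ∎
  where open ≡-Reasoning

module _ {A : Set} (f : A → A) where

  iter-suc : ∀ t a → iter (suc t) f a ≡ iter t f (f a)
  iter-suc zero    a = refl
  iter-suc (suc t) a = cong f (iter-suc t a)

  iter-+ : ∀ s t a → iter (s + t) f a ≡ iter s f (iter t f a)
  iter-+ zero    t a = refl
  iter-+ (suc s) t a = cong f (iter-+ s t a)

  iter-fixed : ∀ t {a} → f a ≡ a → iter t f a ≡ a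
  iter-fixed zero    fa≡a = refl
  iter-fixed (suc t) fa≡a = trans (cong f (iter-fixed t fa≡a)) fa≡a

  Reaches : A → A → Set
  Reaches a b = Σ ℕ λ t → iter t f a ≡ b

  reaches-trans : ∀ {a b c} → Reaches a b → Reaches b c → Reaches a c
  reaches-trans {a} (s , refl) (t , refl) = t + s , iter-+ t s a

  reaches-snoc : ∀ {a b c} → Reaches a b → f b ≡ c → Reaches a c
  reaches-snoc (t , refl) fb≡c = suc t , fb≡c

  reaches-cons : ∀ {a b} → Reaches (f a) b → Reaches a b
  reaches-cons {a} (t , refl) = suc t , iter-suc t a

  reaches-fixed-unique : ∀ {a b c} → f b ≡ b → f c ≡ c → Reaches a b → Reaches a c → b ≡ c
  reaches-fixed-unique {a} fb≡b fc≡c (s , refl) (t , refl) = begin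
    iter s f a                ≡⟨ sym (iter-fixed t fb≡b) ⟩
    iter t f (iter s f a)     ≡⟨ sym (iter-+ t s a) ⟩
    iter (t + s) f a          ≡⟨ cong (λ u → iter u f a) (+-comm t s) ⟩
    iter (s + t) f a          ≡⟨ iter-+ s t a ⟩
    iter s f (iter t f a)     ≡⟨ iter-fixed s fc≡c ⟩
    iter t f a                ∎
    where open ≡-Reasoning

loopStep : (ℕ → ℕ) → ℕ ⊎ ℕ → ℕ ⊎ ℕ
loopStep g = [ decode ∘ g , inj₂ ]′

Semidecision : Set → Set
Semidecision P = Σ (ℕ → Bool) λ α → P ⇔ Σ ℕ (λ k → α k ≡ true)

-- code n k = 2 ^ k * (2 n + 1)
code : ℕ → ℕ → ℕ
code n zero    = encode (inj₂ n)
code n (suc k) = encode (inj₁ (code n k))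

k<code : ∀ n k → k < code n k
k<code n zero    = s≤s z≤n
k<code n (suc k) = +-mono-≤ (≤-trans (s≤s z≤n) k<c) k<c
  where k<c = k<code n k

uncodeWithin : ℕ → ℕ → ℕ × ℕ
uncodeWithin zero       x = 0 , 0
uncodeWithin (suc fuel) x = [ map₂ suc ∘ uncodeWithin fuel , (_, 0) ]′ (decode x)

uncodeWithin-code : ∀ {fuel} n k → k < fuel → uncodeWithin fuel (code n k) ≡ (n , k)
uncodeWithin-code {suc fuel} n zero    _ =
  cong [ map₂ suc ∘ uncodeWithin fuel , (_, 0) ]′ (decode-encode (inj₂ n))
uncodeWithin-code {suc fuel} n (suc k) (s≤s k<fuel) =
  trans (cong [ map₂ suc ∘ uncodeWithin fuel , (_, 0) ]′ (decode-encode (inj₁ (code n k))))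
        (cong (map₂ suc) (uncodeWithin-code n k k<fuel))

uncode : ℕ → ℕ × ℕ
uncode x = uncodeWithin x x

uncode-code : ∀ n k → uncode (code n k) ≡ (n , k)
uncode-code n k = uncodeWithin-code n k (k<code n k)

module Search (f : ℕ → 𝓛 ℕ) (semidecision : ∀ n → Semidecision (defined (f n))) where

  α : ℕ → ℕ → Bool
  α n = proj₁ (semidecision n)

  witness : ∀ n k → α n k ≡ true → defined (f n)
  witness n k e = Equivalence.from (proj₂ (semidecision n)) (k , e)

  searchStep : ∀ n k b → α n k ≡ b → ℕ ⊎ ℕ
  searchStep n k true  e = inj₂ (value (f n) (witness n k e))
  searchStep n k false _ = inj₁ (code n (suc k))

  searchStep-cases : ∀ n k b (e : α n k ≡ b) →
                     Σ (defined (f n)) (λ d → searchStep n k b e ≡ inj₂ (value (f n) d))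
                   ⊎ (α n k ≡ false × searchStep n k b e ≡ inj₁ (code n (suc k)))
  searchStep-cases n k true  e = inj₁ (witness n k e , refl)
  searchStep-cases n k false e = inj₂ (e , refl)

  searchAt : ℕ → ℕ → ℕ ⊎ ℕ
  searchAt n k = searchStep n k (α n k) refl

  searchFun : ℕ → ℕ
  searchFun x = encode (uncurry searchAt (uncode x))

  L : ℕ ⊎ ℕ → ℕ ⊎ ℕ
  L = loopStep searchFun

  L-code : ∀ n k → L (inj₁ (code n k)) ≡ searchAt n k
  L-code n k = trans (decode-encode _) (cong (uncurry searchAt) (uncode-code n k))

  search-trace : ∀ n k → Σ (defined (f n)) (λ d → iter k L (inj₁ (code n 0)) ≡ inj₂ (value (f n) d))
                       ⊎ iter k L (inj₁ (code n 0)) ≡ inj₁ (code n k)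
  search-trace n zero = inj₂ refl
  search-trace n (suc k) with search-trace n k
  ... | inj₁ (d , halted) = inj₁ (d , cong L halted)
  ... | inj₂ at-k with searchStep-cases n k (α n k) refl
  ...   | inj₁ (d , e) = inj₁ (d , trans (cong L at-k) (trans (L-code n k) e))
  ...   | inj₂ (_ , e) = inj₂ (trans (cong L at-k) (trans (L-code n k) e))

  search-sound : ∀ n {y} → Reaches L (inj₁ (code n 0)) (inj₂ y) → defined (f n)
  search-sound n (k , halted) with search-trace n k
  ... | inj₁ (d , _) = d
  ... | inj₂ at-k with trans (sym at-k) halted
  ...   | ()

  search-complete : ∀ n (d : defined (f n)) → Reaches L (inj₁ (code n 0)) (inj₂ (value (f n) d))
  search-complete n d with Equivalence.to (proj₂ (semidecision n)) d
  ... | k , αnk with search-trace n k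
  ...   | inj₁ (d′ , halted) = k , trans halted (cong inj₂ (value-irrelevant (f n) d′ d))
  ...   | inj₂ at-k with searchStep-cases n k (α n k) refl
  ...     | inj₁ (d′ , e) = suc k ,
    trans (cong L at-k) (trans (L-code n k) (trans e (cong inj₂ (value-irrelevant (f n) d′ d))))
  ...     | inj₂ (αnk≡false , _) with trans (sym αnk) αnk≡false
  ...       | ()

-- On input x the machine starts m on ⟦ p ⟧₁ x; whenever m halts with output encode (inj₁ c)
-- it restarts m on c, and when m halts with output encode (inj₂ v) it halts with v.
whileMachine : PR 1 → Machine → Machine
whileMachine p (i , s) = i ∘₁ p , pr-resume i ∘₁ s

step-whileMachine : ∀ p i s z →
                    step (whileMachine p (i , s)) (inj₁ z) ≡ resume i (step (i , s) (inj₁ z))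
step-whileMachine p i s z = decode-pr-resume i (⟦ s ⟧₁ z)

module Computation (pt : PropTrunc) where
  open PropTrunc pt
  open WithTrunc pt

  ∥∥-map : ∀ {a b} {A : Set a} {B : Set b} → (A → B) → ∥ A ∥ → ∥ B ∥
  ∥∥-map f = ∥∥-rec ∥∥-isProp (∣_∣ ∘ f)

  ∥∥-zipWith : ∀ {a b c} {A : Set a} {B : Set b} {C : Set c} →
               (A → B → C) → ∥ A ∥ → ∥ B ∥ → ∥ C ∥
  ∥∥-zipWith f a b = ∥∥-rec ∥∥-isProp (λ x → ∥∥-map (f x) b) a

  Halts : Machine → ℕ → ℕ → Set
  Halts m x y = ∥ Reaches (step m) (inj₁ (⟦ proj₁ m ⟧₁ x)) (inj₂ y) ∥

  ≡-eval : FunExt → PropExt → (l : 𝓛 ℕ) (m : Machine) (x : ℕ) →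
           (∀ d → Halts m x (value l d)) → (∀ {y} → Halts m x y → defined l) → l ≡ eval m x
  ≡-eval funext propext l m x halts-with-value halts-only-if-defined =
    𝓛-ext funext propext l (eval m x) (λ d → value l d , halts-with-value d)
          (λ (_ , h) → halts-only-if-defined h) (λ _ → refl)

  total-halts : ∀ {g m} → η ∘ g ≡ eval m → ∀ x → Halts m x (g x)
  total-halts {g} {m} η∘g≡m x with η-≡ (cong-app η∘g≡m x)
  ... | (y , h) , y≡gx = subst (Halts m x) y≡gx h

  module While (i s : PR 1) (g : ℕ → ℕ) (halts : ∀ c → Halts (i , s) c (g c)) (p : PR 1) where

    m M : Machine
    m = i , s
    M = whileMachine p m

    enter : ℕ ⊎ ℕ → ℕ ⊎ ℕ
    enter = map₁ ⟦ i ⟧₁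

    simulate : ∀ t z b → iter t (step m) (inj₁ z) ≡ inj₂ b →
               Reaches (step M) (inj₁ z) (enter (decode b))
    simulate zero z b ()
    simulate (suc t) z b e = first-step (step m (inj₁ z)) refl (trans (sym (iter-suc _ t _)) e)
      where
      first-step : ∀ r → step m (inj₁ z) ≡ r → iter t (step m) r ≡ inj₂ b →
                   Reaches (step M) (inj₁ z) (enter (decode b))
      first-step (inj₁ z′) z↦z′ rest =
        reaches-cons _ (subst (λ r → Reaches (step M) r _) (sym M-step) (simulate t z′ b rest))
        where
        M-step : step M (inj₁ z) ≡ inj₁ z′
        M-step = trans (step-whileMachine p i s z) (cong (resume i) z↦z′)
      first-step (inj₂ b′) z↦b′ rest = 1 , trans (step-whileMachine p i s z)
        (cong (resume i) (trans z↦b′ (trans (sym (iter-fixed _ t refl)) rest)))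

    L : ℕ ⊎ ℕ → ℕ ⊎ ℕ
    L = loopStep g

    simulate-loopStep : ∀ a → ∥ Reaches (step M) (enter a) (enter (L a)) ∥
    simulate-loopStep (inj₁ c) = ∥∥-map (λ (t , e) → simulate t (⟦ i ⟧₁ c) (g c) e) (halts c)
    simulate-loopStep (inj₂ v) = ∣ 0 , refl ∣

    simulate-loop : ∀ t a → ∥ Reaches (step M) (enter a) (enter (iter t L a)) ∥
    simulate-loop zero    a = ∣ 0 , refl ∣
    simulate-loop (suc t) a rewrite iter-suc L t a =
      ∥∥-zipWith (reaches-trans _) (simulate-loopStep a) (simulate-loop t (L a))

    while-complete : ∀ x y → ∥ Reaches L (inj₁ (⟦ p ⟧₁ x)) (inj₂ y) ∥ → Halts M x y
    while-complete x y = ∥∥-rec ∥∥-isProp λ (t , e) →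
      subst (λ r → ∥ Reaches (step M) _ (enter r) ∥) e (simulate-loop t (inj₁ (⟦ p ⟧₁ x)))

    module _ (a₀ : ℕ ⊎ ℕ) where

      -- Preserved by step M because m is deterministic: started on c, it can only halt with g c.
      Traced : ℕ ⊎ ℕ → Set
      Traced (inj₁ z) =
        ∥ Σ ℕ (λ c → Reaches L a₀ (inj₁ c) × Reaches (step m) (inj₁ (⟦ i ⟧₁ c)) (inj₁ z)) ∥
      Traced (inj₂ y) = ∥ Reaches L a₀ (inj₂ y) ∥

      Traced-isProp : ∀ r → isProp (Traced r)
      Traced-isProp (inj₁ z) = ∥∥-isProp
      Traced-isProp (inj₂ y) = ∥∥-isProp

      enter-traced : ∀ r → Reaches L a₀ r → Traced (enter r)
      enter-traced (inj₁ c) a₀↠c = ∣ c , a₀↠c , 0 , refl ∣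
      enter-traced (inj₂ y) a₀↠y = ∣ a₀↠y ∣

      step-traced : ∀ r → Traced r → Traced (step M r)
      step-traced (inj₂ y) traced = traced
      step-traced (inj₁ z) traced = subst Traced (sym (step-whileMachine p i s z))
        (∥∥-rec (Traced-isProp (resume i (step m (inj₁ z))))
                (λ (c , a₀↠c , c↠z) → after c a₀↠c c↠z (step m (inj₁ z)) refl) traced)
        where
        after : ∀ c → Reaches L a₀ (inj₁ c) → Reaches (step m) (inj₁ (⟦ i ⟧₁ c)) (inj₁ z) →
                ∀ r → step m (inj₁ z) ≡ r → Traced (resume i r)
        after c a₀↠c c↠z (inj₁ z′) z↦z′ = ∣ c , a₀↠c , reaches-snoc _ c↠z z↦z′ ∣
        after c a₀↠c c↠z (inj₂ b) z↦b = ∥∥-rec (Traced-isProp (resume i (inj₂ b))) (λ c↠gc →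
          subst (Traced ∘ enter ∘ decode)
                (inj₂-injective (reaches-fixed-unique _ refl refl c↠gc (reaches-snoc _ c↠z z↦b)))
                (enter-traced (L (inj₁ c)) (reaches-snoc _ a₀↠c refl)))
          (halts c)

      iter-traced : ∀ t → Traced (iter t (step M) (enter a₀))
      iter-traced zero    = enter-traced a₀ (0 , refl)
      iter-traced (suc t) = step-traced (iter t (step M) (enter a₀)) (iter-traced t)

    while-sound : ∀ x y → Halts M x y → ∥ Reaches L (inj₁ (⟦ p ⟧₁ x)) (inj₂ y) ∥
    while-sound x y = ∥∥-rec ∥∥-isProp λ (t , e) → subst (Traced a₀) e (iter-traced a₀ t)
      where a₀ = inj₁ (⟦ p ⟧₁ x)

  rosolini-semidecidable : ∀ {P} → isRosolini P → ∥ Semidecision P ∥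
  rosolini-semidecidable = ∥∥-map λ (α , _ , P≡∃α) →
    α , mk⇔ (subst (λ X → X) P≡∃α) (subst (λ X → X) (sym P≡∃α))

  search-computes : FunExt → PropExt → (f : ℕ → 𝓛 ℕ)
                    (semidecision : ∀ n → Semidecision (defined (f n))) (i s : PR 1) →
                    η ∘ Search.searchFun f semidecision ≡ eval (i , s) →
                    f ≡ eval (whileMachine pr-inr (i , s))
  search-computes funext propext f semidecision i s computes = funext λ n →
    ≡-eval funext propext (f n) M n
      (λ d → while-complete n _ (from-code n ∣ search-complete n d ∣))
      (∥∥-rec (proj₁ (proj₂ (f n))) (search-sound n) ∘ to-code n ∘ while-sound n _)
    where
    open Search f semidecision
    open While i s searchFun (total-halts computes) pr-inr using (M; while-complete; while-sound)

    from-code : ∀ n {y} → ∥ Reaches L (inj₁ (code n 0)) y ∥ → ∥ Reaches L (inj₁ (⟦ pr-inr ⟧₁ n)) y ∥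
    from-code n {y} = subst (λ a → ∥ Reaches L (inj₁ a) y ∥) (sym (⟦pr-inr⟧ n))

    to-code : ∀ n {y} → ∥ Reaches L (inj₁ (⟦ pr-inr ⟧₁ n)) y ∥ → ∥ Reaches L (inj₁ (code n 0)) y ∥
    to-code n {y} = subst (λ a → ∥ Reaches L (inj₁ a) y ∥) (⟦pr-inr⟧ n)

theorem9p14 : (funext : FunExt) (propext : PropExt) (pt : PropTrunc)
    → WithTrunc.CountableChoice pt
    → WithTrunc.ChurchThesis pt
    → (f : ℕ → 𝓛 ℕ)
    → ((n : ℕ) → WithTrunc.isRosolini pt (defined (f n)))
    → WithTrunc.isComputable pt f
theorem9p14 funext propext pt countable-choice church f rosolini =
  ∥∥-rec ∥∥-isProp computable
    (countable-choice _ (λ n → rosolini-semidecidable (rosolini n)))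
  where
  open PropTrunc pt
  open Computation pt

  computable : (∀ n → Semidecision (defined (f n))) → WithTrunc.isComputable pt f
  computable semidecision = ∥∥-map (λ ((i , s) , computes) →
      whileMachine pr-inr (i , s) , search-computes funext propext f semidecision i s computes)
    (church (Search.searchFun f semidecision))
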